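{- Let $s\ge 1$ and $n$ be integers with $s\le n<2s$. Then, as formal power series in $z,t$, $$T_n(s,z,t)=\frac{1}{1-z-(n-s+1)z^st}.$$
   Context: For positive integers $s,n$ and a nonnegative integer $m$, $T_{n\times m}(s,k)$ denotes the number of tilings of an $n\times m$ rectangle (width $n$, length $m$, on the unit grid) by exactly $k$ non-overlapping $s\times s$ squares with sides on grid lines together with $nm-ks^2$ unit ($1\times 1$) squares covering the rest (rotations/reflections counted as distinct; the empty rectangle $m=0$ has the single empty tiling with $k=0$). The bivariate generating function is $T_n(s,z,t)=\sum_{m\ge 0}\sum_{k\ge 0}T_{n\times m}(s,k)z^mt^k$. -}

module Defs where

open import Data.Nat as ℕ using (ℕ; zero; suc; _≤_; _≤?_; _∸_)
open import Data.Integer as ℤ using (ℤ; +_; 0ℤ; 1ℤ)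
open import Data.List using (List; []; _∷_; _++_; map; length; filter; concatMap; upTo)
open import Data.Product using (_×_; _,_)
open import Data.Sum using (_⊎_)
open import Relation.Nullary using (Dec; yes; no)
open import Relation.Nullary.Decidable using (_⊎-dec_; _×-dec_)
open import Relation.Binary.PropositionalEquality using (_≡_)
open import Data.List.Relation.Unary.AllPairs using (AllPairs)
open import Data.List.Relation.Unary.AllPairs.Properties using ()
import Data.List.Relation.Unary.AllPairs as AP

-- Cells have coordinates (i , j) with 0 ≤ i < n (width) and 0 ≤ j < m
-- (length).  An s × s square with sides on grid lines inside the
-- rectangle is determined by its lower-left corner (i , j) with
-- i + s ≤ n and j + s ≤ m.  A tiling by k s × s squares and unit
-- squares is determined by (and determines) the set of positions of
-- its k s × s squares, which must be pairwise non-overlapping; the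
-- remaining cells are covered by unit squares in exactly one way.

Pos : Set
Pos = ℕ × ℕ

placements : ℕ → ℕ → ℕ → List Pos
placements s n m =
  concatMap (λ i → map (λ j → (i , j)) (upTo (suc (m ∸ s))))
            (upTo (suc (n ∸ s)))
-- (guard: only when s ≤ n and s ≤ m are there any placements)

validPlacements : ℕ → ℕ → ℕ → List Pos
validPlacements s n m with s ≤? n | s ≤? m
... | yes _ | yes _ = placements s n m
... | _         | _         = []

Disjoint : ℕ → Pos → Pos → Set
Disjoint s (i , j) (i' , j') =
  ((i ℕ.+ s ≤ i') ⊎ (i' ℕ.+ s ≤ i)) ⊎ ((j ℕ.+ s ≤ j') ⊎ (j' ℕ.+ s ≤ j))

disjoint? : (s : ℕ) → (p q : Pos) → Dec (Disjoint s p q)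
disjoint? s (i , j) (i' , j') =
  ((i ℕ.+ s ≤? i') ⊎-dec (i' ℕ.+ s ≤? i)) ⊎-dec ((j ℕ.+ s ≤? j') ⊎-dec (j' ℕ.+ s ≤? j))

-- all sublists (= subsets, since the placement list has no duplicates)
sublists : {A : Set} → List A → List (List A)
sublists [] = [] ∷ []
sublists (x ∷ xs) = let r = sublists xs in r ++ map (x ∷_) r

ValidSet : ℕ → ℕ → List Pos → Set
ValidSet s k ps = (length ps ≡ k) × AllPairs (Disjoint s) ps

validSet? : (s k : ℕ) → (ps : List Pos) → Dec (ValidSet s k ps)
validSet? s k ps = (length ps ℕ.≟ k) ×-dec AP.allPairs? (disjoint? s) ps

T : ℕ → ℕ → ℕ → ℕ → ℕ
T n m s k = length (filter (validSet? s k) (sublists (validPlacements s n m)))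

-- Formal power series in two variables z, t with integer coefficients:
-- f m k is the coefficient of z^m t^k.

PS : Set
PS = ℕ → ℕ → ℤ

_≈ₚ_ : PS → PS → Set
f ≈ₚ g = ∀ m k → f m k ≡ g m k

sumTo : ℕ → (ℕ → ℤ) → ℤ
sumTo zero g = g zero
sumTo (suc N) g = sumTo N g ℤ.+ g (suc N)

_*ₚ_ : PS → PS → PS
(f *ₚ g) m k = sumTo m (λ a → sumTo k (λ b → f a b ℤ.* g (m ∸ a) (k ∸ b)))

_+ₚ_ : PS → PS → PS
(f +ₚ g) m k = f m k ℤ.+ g m k

-ₚ_ : PS → PS
(-ₚ f) m k = ℤ.- f m k

mono : ℤ → ℕ → ℕ → PS
mono c a b m k with m ℕ.≟ a | k ℕ.≟ b
... | yes _ | yes _ = c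
... | _         | _         = 0ℤ

oneₚ : PS
oneₚ = mono 1ℤ 0 0

Tgf : ℕ → ℕ → PS
Tgf n s m k = + T n m s k

-- Since n < 2s, two s × s squares whose corners lie in columns less than s apart always overlap,
-- because their offsets across the width differ by at most n − s < s. A tiling is therefore a set of
-- columns pairwise at least s apart, each carrying one of n − s + 1 positions. Splitting on whether
-- the last possible column m − s is used gives T(m+1, k+1) = T(m, k+1) + (n − s + 1) T(m+1−s, k),
-- and with T(m, 0) = 1 and T(m, k+1) = 0 for m < s these are exactly the coefficient equations of
-- T_n · (1 − z − (n − s + 1) zˢ t) = 1.

module Submission where

open import Algebra.Properties.CommutativeSemigroup using (interchange)
open import Data.Bool using (true; false)
import Data.Integer.Properties as ℤ
open import Data.List using (List; []; _∷_; _++_; map; length; filter; concatMap; upTo; downFrom)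
import Data.List.Properties as List
open import Data.List.Relation.Binary.Permutation.Propositional using (_↭_; prep; swap; ↭-sym; ↭-reflexive; ↭-trans)
import Data.List.Relation.Binary.Permutation.Propositional as ↭
import Data.List.Relation.Binary.Permutation.Propositional.Properties as ↭
import Data.List.Relation.Binary.Permutation.Setoid.Properties as ↭ₛ
open import Data.List.Relation.Unary.All as All using (All; []; _∷_; all?)
import Data.List.Relation.Unary.All.Properties as All
open import Data.List.Relation.Unary.AllPairs as AllPairs using (AllPairs; []; _∷_; allPairs?)
import Data.List.Relation.Unary.AllPairs.Properties as AllPairs
open import Data.Nat as ℕ using (ℕ; zero; suc; _∸_; _≤_; _<_; _⊓_; z≤n; s≤s; _≤?_; _≟_)
import Data.Nat.Properties as ℕ
open import Data.Product using (_×_; _,_)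
import Data.Sum as Sum
open import Data.Sum using (_⊎_; inj₁; inj₂)
open import Function using (_∘_; id)
open import Level using (Level)
open import Relation.Binary using (Rel; Symmetric)
open import Relation.Binary.Definitions as B using (_Respects_)
open import Relation.Binary.PropositionalEquality
open import Relation.Nullary using (¬_; yes; no; does; contradiction)
open import Relation.Nullary.Decidable using (_×-dec_)
open import Relation.Unary using (Pred; Decidable; _≐_)

open import Defs

module PowerSeries where

  open import Data.Integer using (ℤ; 0ℤ; 1ℤ; _+_; _*_; -_; _-_)
  open import Data.Integer.Tactic.RingSolver using (solve-∀)

  sumTo-cong : ∀ N {f g : ℕ → ℤ} → (∀ i → i ≤ N → f i ≡ g i) → sumTo N f ≡ sumTo N g
  sumTo-cong zero    f≗g = f≗g 0 z≤n
  sumTo-cong (suc N) f≗g =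
    cong₂ _+_ (sumTo-cong N λ i i≤N → f≗g i (ℕ.m≤n⇒m≤1+n i≤N)) (f≗g (suc N) ℕ.≤-refl)

  sumTo-zero : ∀ N {f : ℕ → ℤ} → (∀ i → i ≤ N → f i ≡ 0ℤ) → sumTo N f ≡ 0ℤ
  sumTo-zero zero    f≗0 = f≗0 0 z≤n
  sumTo-zero (suc N) f≗0 =
    cong₂ _+_ (sumTo-zero N λ i i≤N → f≗0 i (ℕ.m≤n⇒m≤1+n i≤N)) (f≗0 (suc N) ℕ.≤-refl)

  sumTo-single : ∀ N {p} {f : ℕ → ℤ} → p ≤ N → (∀ i → i ≤ N → i ≢ p → f i ≡ 0ℤ) →
    sumTo N f ≡ f p
  sumTo-single zero    z≤n    _   = refl
  sumTo-single (suc N) {p} {f} p≤1+N off-p with p ≟ suc N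
  ... | yes refl = trans
    (cong (_+ f (suc N)) (sumTo-zero N λ i i≤N → off-p i (ℕ.m≤n⇒m≤1+n i≤N) (ℕ.<⇒≢ (s≤s i≤N))))
    (ℤ.+-identityˡ (f (suc N)))
  ... | no p≢1+N = trans
    (cong₂ _+_ (sumTo-single N (ℕ.≤-pred (ℕ.≤∧≢⇒< p≤1+N p≢1+N)) λ i i≤N → off-p i (ℕ.m≤n⇒m≤1+n i≤N))
               (off-p (suc N) ℕ.≤-refl (p≢1+N ∘ sym)))
    (ℤ.+-identityʳ (f p))

  sumTo-+ : ∀ N (f g : ℕ → ℤ) → sumTo N (λ i → f i + g i) ≡ sumTo N f + sumTo N g
  sumTo-+ zero    f g = refl
  sumTo-+ (suc N) f g = trans (cong (_+ (f (suc N) + g (suc N))) (sumTo-+ N f g))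
                              (interchange ℤ.+-commutativeSemigroup (sumTo N f) (sumTo N g) (f (suc N)) (g (suc N)))

  sumTo-neg : ∀ N (f : ℕ → ℤ) → sumTo N (λ i → - f i) ≡ - sumTo N f
  sumTo-neg zero    f = refl
  sumTo-neg (suc N) f = trans (cong (_+ (- f (suc N))) (sumTo-neg N f)) (sym (ℤ.neg-distrib-+ (sumTo N f) (f (suc N))))

  *ₚ-distribˡ-+ₚ : ∀ f g h → (f *ₚ (g +ₚ h)) ≈ₚ ((f *ₚ g) +ₚ (f *ₚ h))
  *ₚ-distribˡ-+ₚ f g h m k =
    trans (sumTo-cong m λ a _ → trans (sumTo-cong k λ b _ → ℤ.*-distribˡ-+ (f a b) _ _) (sumTo-+ k _ _))
          (sumTo-+ m _ _)

  *ₚ-negʳ : ∀ f g → (f *ₚ (-ₚ g)) ≈ₚ (-ₚ (f *ₚ g))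
  *ₚ-negʳ f g m k =
    trans (sumTo-cong m λ a _ → trans (sumTo-cong k λ b _ → sym (ℤ.neg-distribʳ-* (f a b) _)) (sumTo-neg k _))
          (sumTo-neg m _)

  mono-≡ : ∀ c a b → mono c a b a b ≡ c
  mono-≡ c a b with a ≟ a | b ≟ b
  ... | yes _ | yes _ = refl
  ... | no a≢a | _    = contradiction refl a≢a
  ... | yes _ | no b≢b = contradiction refl b≢b

  mono-≢ : ∀ c a b {x y} → x ≢ a ⊎ y ≢ b → mono c a b x y ≡ 0ℤ
  mono-≢ c a b {x} {y} (inj₁ x≢a) with x ≟ a
  ... | yes x≡a = contradiction x≡a x≢a
  ... | no _    = refl
  mono-≢ c a b {x} {y} (inj₂ y≢b) with x ≟ a | y ≟ b
  ... | _     | yes y≡b = contradiction y≡b y≢b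
  ... | yes _ | no _    = refl
  ... | no _  | no _    = refl

  *ₚ-mono : ∀ f c a b m k → a ≤ m → b ≤ k → (f *ₚ mono c a b) m k ≡ f (m ∸ a) (k ∸ b) * c
  *ₚ-mono f c a b m k a≤m b≤k = begin
    sumTo m (λ i → sumTo k (λ j → f i j * mono c a b (m ∸ i) (k ∸ j)))
      ≡⟨ sumTo-single m (ℕ.m∸n≤m m a) (λ i i≤m i≢ →
           sumTo-zero k λ j _ → term-zero (inj₁ (i≢ ∘ flip i≤m))) ⟩
    sumTo k (λ j → f (m ∸ a) j * mono c a b (m ∸ (m ∸ a)) (k ∸ j))
      ≡⟨ sumTo-single k (ℕ.m∸n≤m k b) (λ j j≤k j≢ → term-zero (inj₂ (j≢ ∘ flip j≤k))) ⟩
    f (m ∸ a) (k ∸ b) * mono c a b (m ∸ (m ∸ a)) (k ∸ (k ∸ b))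
      ≡⟨ cong (f (m ∸ a) (k ∸ b) *_)
           (trans (cong₂ (mono c a b) (ℕ.m∸[m∸n]≡n a≤m) (ℕ.m∸[m∸n]≡n b≤k)) (mono-≡ c a b)) ⟩
    f (m ∸ a) (k ∸ b) * c ∎
    where
    open ≡-Reasoning
    flip : ∀ {n i d} → i ≤ n → n ∸ i ≡ d → i ≡ n ∸ d
    flip i≤n refl = sym (ℕ.m∸[m∸n]≡n i≤n)
    term-zero : ∀ {i j x y} → x ≢ a ⊎ y ≢ b → f i j * mono c a b x y ≡ 0ℤ
    term-zero {i} {j} off = trans (cong (f i j *_) (mono-≢ c a b off)) (ℤ.*-zeroʳ (f i j))

  *ₚ-mono-outside : ∀ f c a b m k → m < a ⊎ k < b → (f *ₚ mono c a b) m k ≡ 0ℤ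
  *ₚ-mono-outside f c a b m k outside = sumTo-zero m λ i _ → sumTo-zero k λ j _ →
    trans (cong (f i j *_) (mono-≢ c a b (Sum.map (below m i) (below k j) outside))) (ℤ.*-zeroʳ (f i j))
    where
    below : ∀ n i {d} → n < d → n ∸ i ≢ d
    below n i n<d = ℕ.<⇒≢ (ℕ.≤-<-trans (ℕ.m∸n≤m n i) n<d)

  1-z-czˢt : ℤ → ℕ → PS
  1-z-czˢt c s = oneₚ +ₚ (-ₚ (mono 1ℤ 1 0 +ₚ mono c s 1))

  *ₚ-1-z-czˢt : ∀ f c s m k →
    (f *ₚ 1-z-czˢt c s) m k ≡ f m k * 1ℤ - ((f *ₚ mono 1ℤ 1 0) m k + (f *ₚ mono c s 1) m k)
  *ₚ-1-z-czˢt f c s m k = begin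
    (f *ₚ 1-z-czˢt c s) m k
      ≡⟨ *ₚ-distribˡ-+ₚ f oneₚ (-ₚ (mono 1ℤ 1 0 +ₚ mono c s 1)) m k ⟩
    (f *ₚ oneₚ) m k + (f *ₚ (-ₚ (mono 1ℤ 1 0 +ₚ mono c s 1))) m k
      ≡⟨ cong₂ _+_ (*ₚ-mono f 1ℤ 0 0 m k z≤n z≤n) (*ₚ-negʳ f (mono 1ℤ 1 0 +ₚ mono c s 1) m k) ⟩
    f m k * 1ℤ - (f *ₚ (mono 1ℤ 1 0 +ₚ mono c s 1)) m k
      ≡⟨ cong (λ x → f m k * 1ℤ - x) (*ₚ-distribˡ-+ₚ f (mono 1ℤ 1 0) (mono c s 1) m k) ⟩
    f m k * 1ℤ - ((f *ₚ mono 1ℤ 1 0) m k + (f *ₚ mono c s 1) m k) ∎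
    where open ≡-Reasoning

  recurrence⇒inverse : ∀ (f : PS) c s → 0 < s →
    (∀ m → f m 0 ≡ 1ℤ) →
    (∀ m k → m < s → f m (suc k) ≡ 0ℤ) →
    (∀ m k → s ≤ suc m → f (suc m) (suc k) ≡ f m (suc k) + c * f (suc m ∸ s) k) →
    (f *ₚ 1-z-czˢt c s) ≈ₚ oneₚ
  recurrence⇒inverse f c s s>0 t⁰-coeff low-coeff recurrence = coefficient
    where
    split : ∀ {m k x y w} → f m k ≡ x → (f *ₚ mono 1ℤ 1 0) m k ≡ y → (f *ₚ mono c s 1) m k ≡ w →
      (f *ₚ 1-z-czˢt c s) m k ≡ x * 1ℤ - (y + w)
    split {m} {k} refl refl refl = *ₚ-1-z-czˢt f c s m k

    z-at-0 : ∀ k → (f *ₚ mono 1ℤ 1 0) 0 k ≡ 0ℤ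
    z-at-0 k = *ₚ-mono-outside f 1ℤ 1 0 0 k (inj₁ (s≤s z≤n))

    z-shift : ∀ m k → (f *ₚ mono 1ℤ 1 0) (suc m) k ≡ f m k * 1ℤ
    z-shift m k = *ₚ-mono f 1ℤ 1 0 (suc m) k (s≤s z≤n) z≤n

    czˢt-outside : ∀ m k → m < s ⊎ k < 1 → (f *ₚ mono c s 1) m k ≡ 0ℤ
    czˢt-outside = *ₚ-mono-outside f c s 1

    cancel : ∀ x y c → (x + c * y) * 1ℤ - (x * 1ℤ + y * c) ≡ 0ℤ
    cancel = solve-∀

    coefficient : (f *ₚ 1-z-czˢt c s) ≈ₚ oneₚ
    coefficient zero zero = split (t⁰-coeff 0) (z-at-0 0) (czˢt-outside 0 0 (inj₁ s>0))
    coefficient zero (suc k) = split (low-coeff 0 k s>0) (z-at-0 (suc k)) (czˢt-outside 0 (suc k) (inj₁ s>0))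
    coefficient (suc m) zero =
      split (t⁰-coeff (suc m)) (trans (z-shift m 0) (cong (_* 1ℤ) (t⁰-coeff m)))
            (czˢt-outside (suc m) 0 (inj₂ (s≤s z≤n)))
    coefficient (suc m) (suc k) with s ≤? suc m
    ... | yes s≤1+m = trans
      (split (recurrence m k s≤1+m) (z-shift m (suc k)) (*ₚ-mono f c s 1 (suc m) (suc k) s≤1+m (s≤s z≤n)))
      (cancel (f m (suc k)) (f (suc m ∸ s) k) c)
    ... | no s≰1+m =
      split (low-coeff (suc m) k 1+m<s) (trans (z-shift m (suc k)) (cong (_* 1ℤ) (low-coeff m k (ℕ.<⇒≤ 1+m<s))))
            (czˢt-outside (suc m) (suc k) (inj₁ 1+m<s))
      where
      1+m<s : suc m < s
      1+m<s = ℕ.≰⇒> s≰1+m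

open import Data.Nat using (_+_; _*_)

open PowerSeries

private
  variable
    ℓ ℓ′ : Level
    A B C : Set

length-filter-map : {P : Pred B ℓ} (P? : Decidable P) (f : A → B) (xs : List A) →
  length (filter P? (map f xs)) ≡ length (filter (P? ∘ f) xs)
length-filter-map P? f [] = refl
length-filter-map P? f (x ∷ xs) with does (P? (f x))
... | true  = cong suc (length-filter-map P? f xs)
... | false = length-filter-map P? f xs

countSublists : {P : Pred (List A) ℓ} → Decidable P → List A → ℕ
countSublists P? xs = length (filter P? (sublists xs))

module _ {P : Pred (List A) ℓ} (P? : Decidable P) where

  countSublists-∷ : ∀ x xs →
    countSublists P? (x ∷ xs) ≡ countSublists P? xs + countSublists (P? ∘ (x ∷_)) xs
  countSublists-∷ x xs = begin
    length (filter P? (sublists xs ++ map (x ∷_) (sublists xs)))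
      ≡⟨ cong length (List.filter-++ P? (sublists xs) _) ⟩
    length (filter P? (sublists xs) ++ filter P? (map (x ∷_) (sublists xs)))
      ≡⟨ List.length-++ (filter P? (sublists xs)) ⟩
    countSublists P? xs + length (filter P? (map (x ∷_) (sublists xs)))
      ≡⟨ cong (countSublists P? xs +_) (length-filter-map P? (x ∷_) (sublists xs)) ⟩
    countSublists P? xs + countSublists (P? ∘ (x ∷_)) xs ∎
    where open ≡-Reasoning

  countSublists-none : (∀ ys → ¬ P ys) → ∀ xs → countSublists P? xs ≡ 0
  countSublists-none ¬P xs = cong length (List.filter-none P? (All.universal ¬P (sublists xs)))

countSublists-≐ : {P : Pred (List A) ℓ} {Q : Pred (List A) ℓ′} (P? : Decidable P) (Q? : Decidable Q) →
  P ≐ Q → ∀ xs → countSublists P? xs ≡ countSublists Q? xs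
countSublists-≐ P? Q? P≐Q xs = cong length (List.filter-≐ P? Q? P≐Q (sublists xs))

countSublists-resp-↭ : {P : Pred (List A) ℓ} (P? : Decidable P) → P Respects _↭_ →
  ∀ {xs ys} → xs ↭ ys → countSublists P? xs ≡ countSublists P? ys
countSublists-resp-↭ P? resp ↭.refl = refl
countSublists-resp-↭ P? resp (prep {xs} {ys} x p) = begin
  countSublists P? (x ∷ xs)                              ≡⟨ countSublists-∷ P? x xs ⟩
  countSublists P? xs + countSublists (P? ∘ (x ∷_)) xs
    ≡⟨ cong₂ _+_ (countSublists-resp-↭ P? resp p) (countSublists-resp-↭ (P? ∘ (x ∷_)) (resp ∘ prep x) p) ⟩
  countSublists P? ys + countSublists (P? ∘ (x ∷_)) ys  ≡⟨ countSublists-∷ P? x ys ⟨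
  countSublists P? (x ∷ ys)                              ∎
  where open ≡-Reasoning
countSublists-resp-↭ {P = P} P? resp (swap {xs} {ys} x y p) = begin
  countSublists P? (x ∷ y ∷ xs)
    ≡⟨ countSublists-∷ P? x (y ∷ xs) ⟩
  countSublists P? (y ∷ xs) + countSublists Pₓ (y ∷ xs)
    ≡⟨ cong₂ _+_ (countSublists-∷ P? y xs) (countSublists-∷ Pₓ y xs) ⟩
  (countSublists P? xs + countSublists Pᵧ xs) + (countSublists Pₓ xs + countSublists Pₓᵧ xs)
    ≡⟨ interchange ℕ.+-commutativeSemigroup
         (countSublists P? xs) (countSublists Pᵧ xs) (countSublists Pₓ xs) (countSublists Pₓᵧ xs) ⟩
  (countSublists P? xs + countSublists Pₓ xs) + (countSublists Pᵧ xs + countSublists Pₓᵧ xs)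
    ≡⟨ cong₂ _+_ (cong₂ _+_ (countSublists-resp-↭ P? resp p) (countSublists-resp-↭ Pₓ (resp ∘ prep x) p))
                 (cong₂ _+_ (countSublists-resp-↭ Pᵧ (resp ∘ prep y) p)
                            (trans (countSublists-resp-↭ Pₓᵧ (resp ∘ prep x ∘ prep y) p)
                                   (countSublists-≐ Pₓᵧ Pᵧₓ (resp (swap x y ↭.refl) , resp (swap y x ↭.refl)) ys))) ⟩
  (countSublists P? ys + countSublists Pₓ ys) + (countSublists Pᵧ ys + countSublists Pᵧₓ ys)
    ≡⟨ cong₂ _+_ (countSublists-∷ P? x ys) (countSublists-∷ Pᵧ x ys) ⟨
  countSublists P? (x ∷ ys) + countSublists Pᵧ (x ∷ ys)
    ≡⟨ countSublists-∷ P? y (x ∷ ys) ⟨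
  countSublists P? (y ∷ x ∷ ys) ∎
  where
  open ≡-Reasoning
  Pₓ : Decidable (P ∘ (x ∷_))
  Pₓ = P? ∘ (x ∷_)
  Pᵧ : Decidable (P ∘ (y ∷_))
  Pᵧ = P? ∘ (y ∷_)
  Pₓᵧ : Decidable (P ∘ (x ∷_) ∘ (y ∷_))
  Pₓᵧ = P? ∘ (x ∷_) ∘ (y ∷_)
  Pᵧₓ : Decidable (P ∘ (y ∷_) ∘ (x ∷_))
  Pᵧₓ = P? ∘ (y ∷_) ∘ (x ∷_)
countSublists-resp-↭ P? resp (↭.trans p q) = trans (countSublists-resp-↭ P? resp p) (countSublists-resp-↭ P? resp q)

_×-All?_ : {P : Pred (List A) ℓ} {Q : Pred A ℓ′} → Decidable P → Decidable Q → Decidable (λ ys → P ys × All Q ys)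
(P? ×-All? Q?) ys = P? ys ×-dec all? Q? ys

countSublists-All : {P : Pred (List A) ℓ} {Q : Pred A ℓ′} (P? : Decidable P) (Q? : Decidable Q) →
  ∀ xs → countSublists (P? ×-All? Q?) xs ≡ countSublists P? (filter Q? xs)
countSublists-All P? Q? [] with P? []
... | yes _ = refl
... | no _  = refl
countSublists-All P? Q? (x ∷ xs) with Q? x
... | yes qx = begin
  countSublists (P? ×-All? Q?) (x ∷ xs)
    ≡⟨ countSublists-∷ (P? ×-All? Q?) x xs ⟩
  countSublists (P? ×-All? Q?) xs + countSublists ((P? ×-All? Q?) ∘ (x ∷_)) xs
    ≡⟨ cong₂ _+_ (countSublists-All P? Q? xs)
                 (trans (countSublists-≐ ((P? ×-All? Q?) ∘ (x ∷_)) ((P? ∘ (x ∷_)) ×-All? Q?)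
                                         ((λ (p , qs) → p , All.tail qs) , (λ (p , qs) → p , qx ∷ qs)) xs)
                        (countSublists-All (P? ∘ (x ∷_)) Q? xs)) ⟩
  countSublists P? (filter Q? xs) + countSublists (P? ∘ (x ∷_)) (filter Q? xs)
    ≡⟨ countSublists-∷ P? x (filter Q? xs) ⟨
  countSublists P? (x ∷ filter Q? xs) ∎
  where open ≡-Reasoning
... | no ¬qx = begin
  countSublists (P? ×-All? Q?) (x ∷ xs)
    ≡⟨ countSublists-∷ (P? ×-All? Q?) x xs ⟩
  countSublists (P? ×-All? Q?) xs + countSublists ((P? ×-All? Q?) ∘ (x ∷_)) xs
    ≡⟨ cong₂ _+_ (countSublists-All P? Q? xs)
                 (countSublists-none ((P? ×-All? Q?) ∘ (x ∷_)) (λ _ (_ , qs) → ¬qx (All.head qs)) xs) ⟩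
  countSublists P? (filter Q? xs) + 0
    ≡⟨ ℕ.+-identityʳ _ ⟩
  countSublists P? (filter Q? xs) ∎
  where open ≡-Reasoning

module _ {R : Rel A ℓ} (R? : B.Decidable R) where

  countPairwise : ℕ → List A → ℕ
  countPairwise k = countSublists (λ ys → (length ys ≟ k) ×-dec allPairs? R? ys)

  countPairwise-zero : ∀ xs → countPairwise 0 xs ≡ 1
  countPairwise-zero [] = refl
  countPairwise-zero (x ∷ xs) = begin
    countPairwise 0 (x ∷ xs)
      ≡⟨ countSublists-∷ _ x xs ⟩
    countPairwise 0 xs + countSublists _ xs
      ≡⟨ cong₂ _+_ (countPairwise-zero xs) (countSublists-none _ (λ _ ()) xs) ⟩
    1 ∎
    where open ≡-Reasoning

  countPairwise-∷ : ∀ k x xs →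
    countPairwise (suc k) (x ∷ xs) ≡ countPairwise (suc k) xs + countPairwise k (filter (R? x) xs)
  countPairwise-∷ k x xs =
    trans (countSublists-∷ _ x xs)
          (cong (countPairwise (suc k) xs +_)
                (trans (countSublists-≐ _ (Pairwise? ×-All? R? x)
                                        ((λ (len , R-xys) → (ℕ.suc-injective len , AllPairs.tail R-xys) , AllPairs.head R-xys) ,
                                         (λ ((len , R-ys) , Rx) → cong suc len , Rx ∷ R-ys)) xs)
                       (countSublists-All Pairwise? (R? x) xs)))
    where
    Pairwise? : Decidable (λ ys → length ys ≡ k × AllPairs R ys)
    Pairwise? ys = (length ys ≟ k) ×-dec allPairs? R? ys

  countPairwise-resp-↭ : Symmetric R → ∀ k {xs ys} → xs ↭ ys → countPairwise k xs ≡ countPairwise k ys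
  countPairwise-resp-↭ R-sym k = countSublists-resp-↭ _ λ p (len , R-xs) →
    trans (sym (↭.↭-length p)) len ,
    ↭ₛ.AllPairs-resp-↭ (setoid A) R-sym (resp₂ R) (↭.↭⇒↭ₛ p) R-xs

  -- As the elements of L pairwise conflict, a set counted on the left uses at most one of them.
  countPairwise-++ : ∀ k {L H H′} → AllPairs (λ x y → ¬ R x y) L → All (λ x → filter (R? x) H ≡ H′) L →
    countPairwise (suc k) (L ++ H) ≡ countPairwise (suc k) H + length L * countPairwise k H′
  countPairwise-++ k [] [] = sym (ℕ.+-identityʳ _)
  countPairwise-++ k {x ∷ L} {H} {H′} (x≁L ∷ L-conflicting) (x-filter ∷ L-filter) = begin
    countPairwise (suc k) (x ∷ L ++ H)
      ≡⟨ countPairwise-∷ k x (L ++ H) ⟩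
    countPairwise (suc k) (L ++ H) + countPairwise k (filter (R? x) (L ++ H))
      ≡⟨ cong₂ _+_ (countPairwise-++ k L-conflicting L-filter) (cong (countPairwise k) filter-x) ⟩
    (countPairwise (suc k) H + length L * countPairwise k H′) + countPairwise k H′
      ≡⟨ ℕ.+-assoc (countPairwise (suc k) H) _ _ ⟩
    countPairwise (suc k) H + (length L * countPairwise k H′ + countPairwise k H′)
      ≡⟨ cong (countPairwise (suc k) H +_) (ℕ.+-comm (length L * countPairwise k H′) _) ⟩
    countPairwise (suc k) H + suc (length L) * countPairwise k H′ ∎
    where
    open ≡-Reasoning
    filter-x : filter (R? x) (L ++ H) ≡ H′
    filter-x = trans (List.filter-++ (R? x) L H) (cong₂ _++_ (List.filter-none (R? x) x≁L) x-filter)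

concatMap-[] : (xs : List A) → concatMap {B = B} (λ _ → []) xs ≡ []
concatMap-[] [] = refl
concatMap-[] (x ∷ xs) = concatMap-[] xs

concatMap⁺ : (f : A → List B) {xs ys : List A} → xs ↭ ys → concatMap f xs ↭ concatMap f ys
concatMap⁺ f ↭.refl = ↭.refl
concatMap⁺ f (prep x p) = ↭.++⁺ˡ (f x) (concatMap⁺ f p)
concatMap⁺ f (swap x y p) = ↭-trans (↭.shifts (f x) (f y)) (↭.++⁺ˡ (f y) (↭.++⁺ˡ (f x) (concatMap⁺ f p)))
concatMap⁺ f (↭.trans p q) = ↭-trans (concatMap⁺ f p) (concatMap⁺ f q)

map++concatMap-↭ : (f : A → B) (g : A → List B) (xs : List A) →
  map f xs ++ concatMap g xs ↭ concatMap (λ x → f x ∷ g x) xs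
map++concatMap-↭ f g [] = ↭.refl
map++concatMap-↭ f g (x ∷ xs) =
  prep (f x) (↭-trans (↭.shifts (map f xs) (g x)) (↭.++⁺ˡ (g x) (map++concatMap-↭ f g xs)))

grid-transpose : (is : List B) (js : List C) →
  concatMap (λ i → map (i ,_) js) is ↭ concatMap (λ j → map (_, j) is) js
grid-transpose [] js = ↭-reflexive (sym (concatMap-[] js))
grid-transpose (i ∷ is) js =
  ↭-trans (↭.++⁺ˡ (map (i ,_) js) (grid-transpose is js)) (map++concatMap-↭ (i ,_) (λ j → map (_, j) is) js)

upTo↭downFrom : ∀ n → upTo n ↭ downFrom n
upTo↭downFrom n = ↭-trans (↭-sym (↭.↭-reverse (upTo n))) (↭-reflexive (List.reverse-upTo n))

disjoint-sym : ∀ s → Symmetric (Disjoint s)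
disjoint-sym s {_ , _} {_ , _} = Sum.map Sum.swap Sum.swap

column : ℕ → ℕ → List Pos
column r j = map (_, j) (upTo (suc r))

length-column : ∀ r j → length (column r j) ≡ suc r
length-column r j = trans (List.length-map (_, j) (upTo (suc r))) (List.length-upTo (suc r))

-- Highest column first, so that columnsBelow r (suc c) reduces to column r c ++ columnsBelow r c.
columnsBelow : ℕ → ℕ → List Pos
columnsBelow r c = concatMap (column r) (downFrom c)

validPlacements-↭-columnsBelow : ∀ {s n} m → s ≤ n → validPlacements s n m ↭ columnsBelow (n ∸ s) (suc m ∸ s)
validPlacements-↭-columnsBelow {s} {n} m s≤n with s ≤? n | s ≤? m
... | no s≰n | _ = contradiction s≤n s≰n
... | yes _ | yes s≤m = begin
  placements s n m                               ↭⟨ grid-transpose (upTo (suc (n ∸ s))) (upTo (suc (m ∸ s))) ⟩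
  concatMap (column (n ∸ s)) (upTo (suc (m ∸ s))) ↭⟨ concatMap⁺ (column (n ∸ s)) (upTo↭downFrom (suc (m ∸ s))) ⟩
  columnsBelow (n ∸ s) (suc (m ∸ s))             ≡⟨ cong (columnsBelow (n ∸ s)) (ℕ.+-∸-assoc 1 s≤m) ⟨
  columnsBelow (n ∸ s) (suc m ∸ s)               ∎
  where open ↭.PermutationReasoning
... | yes _ | no s≰m = ↭-reflexive (cong (columnsBelow (n ∸ s)) (sym (ℕ.m≤n⇒m∸n≡0 (ℕ.≰⇒> s≰m))))

module _ {s r : ℕ} (s>0 : 0 < s) (r<s : r < s) where

  rows-overlap : ∀ {i i′} → i′ ≤ r → ¬ (i + s ≤ i′)
  rows-overlap i′≤r i+s≤i′ = ℕ.<⇒≱ (ℕ.≤-<-trans i′≤r r<s) (ℕ.m+n≤o⇒n≤o _ i+s≤i′)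

  near-columns-overlap : ∀ {i i′ c j} → i ≤ r → i′ ≤ r → j ≤ c → ¬ (j + s ≤ c) →
    ¬ Disjoint s (i , c) (i′ , j)
  near-columns-overlap i≤r i′≤r j≤c near (inj₁ (inj₁ h)) = rows-overlap i′≤r h
  near-columns-overlap i≤r i′≤r j≤c near (inj₁ (inj₂ h)) = rows-overlap i≤r h
  near-columns-overlap i≤r i′≤r j≤c near (inj₂ (inj₁ h)) = ℕ.<⇒≱ (ℕ.m<m+n _ s>0) (ℕ.≤-trans h j≤c)
  near-columns-overlap i≤r i′≤r j≤c near (inj₂ (inj₂ h)) = near h

  column-conflicting : ∀ c → AllPairs (λ p q → ¬ Disjoint s p q) (column r c)
  column-conflicting c = AllPairs.map⁺ (AllPairs.applyUpTo⁺₁ id (suc r) λ i<j j≤r →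
    near-columns-overlap (ℕ.≤-pred (ℕ.<-trans i<j j≤r)) (ℕ.≤-pred j≤r) ℕ.≤-refl (ℕ.<⇒≱ (ℕ.m<m+n c s>0)))

  filter-column-far : ∀ {i c j} → j + s ≤ c → filter (disjoint? s (i , c)) (column r j) ≡ column r j
  filter-column-far {i} {c} far =
    List.filter-all (disjoint? s (i , c)) (All.map⁺ (All.applyUpTo⁺₂ id (suc r) λ _ → inj₂ (inj₂ far)))

  filter-column-near : ∀ {i c j} → i ≤ r → j ≤ c → ¬ (j + s ≤ c) →
    filter (disjoint? s (i , c)) (column r j) ≡ []
  filter-column-near {i} {c} i≤r j≤c near =
    List.filter-none (disjoint? s (i , c)) (All.map⁺ (All.applyUpTo⁺₁ id (suc r) λ i′≤r →
      near-columns-overlap i≤r (ℕ.≤-pred i′≤r) j≤c near))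

  -- Column j survives the filter iff j + s ≤ c, i.e. iff j < suc c ∸ s.
  filter-columnsBelow : ∀ {i c} → i ≤ r → ∀ b → b ≤ c →
    filter (disjoint? s (i , c)) (columnsBelow r b) ≡ columnsBelow r (b ⊓ (suc c ∸ s))
  filter-columnsBelow i≤r zero _ = refl
  filter-columnsBelow {i} {c} i≤r (suc b) b<c with b + s ≤? c
  ... | yes far = begin
    filter D (columnsBelow r (suc b))
      ≡⟨ List.filter-++ D (column r b) (columnsBelow r b) ⟩
    filter D (column r b) ++ filter D (columnsBelow r b)
      ≡⟨ cong₂ _++_ (filter-column-far {i} far) (filter-columnsBelow i≤r b (ℕ.<⇒≤ b<c)) ⟩
    column r b ++ columnsBelow r (b ⊓ x)
      ≡⟨ cong (λ a → column r b ++ columnsBelow r a) (ℕ.m≤n⇒m⊓n≡m (ℕ.<⇒≤ b<x)) ⟩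
    columnsBelow r (suc b)
      ≡⟨ cong (columnsBelow r) (ℕ.m≤n⇒m⊓n≡m b<x) ⟨
    columnsBelow r (suc b ⊓ x) ∎
    where
    open ≡-Reasoning
    D : Decidable (Disjoint s (i , c))
    D = disjoint? s (i , c)
    x : ℕ
    x = suc c ∸ s
    b<x : b < x
    b<x = ℕ.m+n≤o⇒m≤o∸n (suc b) (s≤s far)
  ... | no near = begin
    filter D (columnsBelow r (suc b))
      ≡⟨ List.filter-++ D (column r b) (columnsBelow r b) ⟩
    filter D (column r b) ++ filter D (columnsBelow r b)
      ≡⟨ cong₂ _++_ (filter-column-near {i} i≤r (ℕ.<⇒≤ b<c) near) (filter-columnsBelow i≤r b (ℕ.<⇒≤ b<c)) ⟩
    columnsBelow r (b ⊓ x)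
      ≡⟨ cong (columnsBelow r) (ℕ.m≥n⇒m⊓n≡n x≤b) ⟩
    columnsBelow r x
      ≡⟨ cong (columnsBelow r) (ℕ.m≥n⇒m⊓n≡n (ℕ.m≤n⇒m≤1+n x≤b)) ⟨
    columnsBelow r (suc b ⊓ x) ∎
    where
    open ≡-Reasoning
    D : Decidable (Disjoint s (i , c))
    D = disjoint? s (i , c)
    x : ℕ
    x = suc c ∸ s
    x≤b : x ≤ b
    x≤b = ℕ.m≤n+o⇒m∸n≤o (suc c) s (subst (suc c ≤_) (ℕ.+-comm b s) (ℕ.≰⇒> near))

  filter-disjoint-columnsBelow : ∀ {i} c → i ≤ r →
    filter (disjoint? s (i , c)) (columnsBelow r c) ≡ columnsBelow r (suc c ∸ s)
  filter-disjoint-columnsBelow c i≤r = trans (filter-columnsBelow i≤r c ℕ.≤-refl)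
    (cong (columnsBelow r) (ℕ.m≥n⇒m⊓n≡n (ℕ.∸-monoʳ-≤ (suc c) s>0)))

  countPairwise-columnsBelow-suc : ∀ k c →
    countPairwise (disjoint? s) (suc k) (columnsBelow r (suc c)) ≡
    countPairwise (disjoint? s) (suc k) (columnsBelow r c) + suc r * countPairwise (disjoint? s) k (columnsBelow r (suc c ∸ s))
  countPairwise-columnsBelow-suc k c = begin
    # (suc k) (column r c ++ columnsBelow r c)
      ≡⟨ countPairwise-++ (disjoint? s) k (column-conflicting c)
           (All.map⁺ (All.applyUpTo⁺₁ id (suc r) λ i<1+r → filter-disjoint-columnsBelow c (ℕ.≤-pred i<1+r))) ⟩
    # (suc k) (columnsBelow r c) + length (column r c) * # k (columnsBelow r (suc c ∸ s))
      ≡⟨ cong (λ l → # (suc k) (columnsBelow r c) + l * # k (columnsBelow r (suc c ∸ s))) (length-column r c) ⟩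
    # (suc k) (columnsBelow r c) + suc r * # k (columnsBelow r (suc c ∸ s)) ∎
    where
    open ≡-Reasoning
    # : ℕ → List Pos → ℕ
    # = countPairwise (disjoint? s)

T≡countPairwise-columnsBelow : ∀ {n s} m k → s ≤ n →
  T n m s k ≡ countPairwise (disjoint? s) k (columnsBelow (n ∸ s) (suc m ∸ s))
T≡countPairwise-columnsBelow {s = s} m k s≤n =
  countPairwise-resp-↭ (disjoint? s) (disjoint-sym s) k (validPlacements-↭-columnsBelow m s≤n)

T-no-squares : ∀ n m s → T n m s 0 ≡ 1
T-no-squares n m s = countPairwise-zero (disjoint? s) (validPlacements s n m)

T-short : ∀ n m s k → m < s → T n m s (suc k) ≡ 0
T-short n m s k m<s with s ≤? n | s ≤? m
... | _     | yes s≤m = contradiction s≤m (ℕ.<⇒≱ m<s)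
... | yes _ | no _    = refl
... | no _  | no _    = refl

T-recurrence : ∀ {n s} m k → 0 < s → s ≤ n → n ∸ s < s → s ≤ suc m →
  T n (suc m) s (suc k) ≡ T n m s (suc k) + (n ∸ s + 1) * T n (suc m ∸ s) s k
T-recurrence {n} {s} m k s>0 s≤n r<s s≤1+m = begin
  T n (suc m) s (suc k)
    ≡⟨ T≡countPairwise-columnsBelow (suc m) (suc k) s≤n ⟩
  # (suc k) (columnsBelow r (suc (suc m) ∸ s))
    ≡⟨ cong (λ c → # (suc k) (columnsBelow r c)) (ℕ.+-∸-assoc 1 s≤1+m) ⟩
  # (suc k) (columnsBelow r (suc (suc m ∸ s)))
    ≡⟨ countPairwise-columnsBelow-suc s>0 r<s k (suc m ∸ s) ⟩
  # (suc k) (columnsBelow r (suc m ∸ s)) + suc r * # k (columnsBelow r (suc (suc m ∸ s) ∸ s))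
    ≡⟨ cong₂ (λ a b → a + b * # k (columnsBelow r (suc (suc m ∸ s) ∸ s)))
             (T≡countPairwise-columnsBelow m (suc k) s≤n) (ℕ.+-comm r 1) ⟨
  T n m s (suc k) + (r + 1) * # k (columnsBelow r (suc (suc m ∸ s) ∸ s))
    ≡⟨ cong (λ x → T n m s (suc k) + (r + 1) * x) (T≡countPairwise-columnsBelow (suc m ∸ s) k s≤n) ⟨
  T n m s (suc k) + (r + 1) * T n (suc m ∸ s) s k ∎
  where
  open ≡-Reasoning
  r : ℕ
  r = n ∸ s
  # : ℕ → List Pos → ℕ
  # = countPairwise (disjoint? s)

open import Data.Integer as ℤ using (+_; 1ℤ)

mainTheorem5 : (s n : ℕ) → 1 ≤ s → s ≤ n → n < 2 * s →
    (Tgf n s *ₚ (oneₚ +ₚ (-ₚ (mono 1ℤ 1 0 +ₚ mono (+ (n ∸ s + 1)) s 1)))) ≈ₚ oneₚ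
mainTheorem5 s n s>0 s≤n n<2s =
  recurrence⇒inverse (Tgf n s) (+ (n ∸ s + 1)) s s>0
    (λ m → cong +_ (T-no-squares n m s))
    (λ m k m<s → cong +_ (T-short n m s k m<s))
    (λ m k s≤1+m → trans (cong +_ (T-recurrence m k s>0 s≤n r<s s≤1+m))
                         (trans (ℤ.pos-+ (T n m s (suc k)) _)
                                (cong (λ x → + T n m s (suc k) ℤ.+ x) (ℤ.pos-* (n ∸ s + 1) _))))
  where
  r<s : n ∸ s < s
  r<s = ℕ.m<n+o⇒m∸n<o n s {{ℕ.>-nonZero s>0}} (subst (n <_) (cong (λ x → s + x) (ℕ.+-identityʳ s)) n<2s)
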